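{- Let $k\geq1$, let $f:U\rightarrow\Phi^c$ be $k$-odd, and for each $i\in[c]$ let $g_i:\Phi\rightarrow\Psi^d$ be $k$-odd. Define $F:U\rightarrow\Psi^{[c]\times[d]}$ by $F(x)_{(i,j)}=g_i(f(x)_i)_j$. Then $F$ is $k$-odd.
   Context: For a function $f:U\to\Sigma^P$ (vectors over alphabet $\Sigma$ indexed by a position set $P$), an output position character is a pair $(p,a)\in P\times\Sigma$. The function $f$ is $k$-odd if every nonempty set $X\subseteq U$ with $|X|\leq k$ has some output position character $(p,a)$ that appears an odd number of times when $f$ is applied to $X$, i.e. $|\{x\in X: f(x)_p=a\}|$ is odd. -}

module Defs where

open import Data.Nat using (ℕ; _≤_; _%_)
open import Data.List using (List; []; length; filter)
open import Data.List.Relation.Unary.Unique.Propositional using (Unique)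
open import Data.Product using (∃-syntax)
open import Relation.Binary.Definitions using (DecidableEquality)
open import Relation.Binary.PropositionalEquality using (_≡_; _≢_)

occurrences : {U Σ P : Set} → DecidableEquality Σ →
              (U → P → Σ) → List U → P → Σ → ℕ
occurrences _≟_ f X p a = length (filter (λ x → f x p ≟ a) X)

-- f : U → Σ^P is k-odd: every nonempty finite set X ⊆ U with |X| ≤ k
-- (represented as a duplicate-free list) has an output position
-- character (p , a) occurring an odd number of times.
KOdd : {U Σ P : Set} → DecidableEquality Σ → ℕ → (U → P → Σ) → Set
KOdd {U} {Σ} {P} _≟_ k f =
  (X : List U) → Unique X → X ≢ [] → length X ≤ k →
  ∃[ p ] ∃[ a ] (occurrences _≟_ f X p a % 2 ≡ 1)

module Submission where

-- Let X be a nonempty duplicate-free list with |X| ≤ k.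
-- Since f is k-odd there are a coordinate i and a symbol a occurring an
-- odd number of times in the column L = (f(x)_i) for x ∈ X.  L is a
-- multiset; reduce it modulo 2 to the set Y = oddPart L of symbols
-- occurring an odd number of times in L.  Then Y is duplicate-free,
-- |Y| ≤ |L| = |X| ≤ k, and for every decidable predicate Q the number of
-- entries of L satisfying Q has the same parity as the number of elements
-- of Y satisfying Q.  Taking Q = (_≡ a) shows that Y is nonempty, so
-- k-oddness of g_i gives (j , b) occurring an odd number of times in
-- g_i(Y); transferring this parity back from Y to L gives the odd output
-- position character ((i , j) , b) of F on X.

open import Defs
open import Data.Nat using (ℕ; suc; _+_; _≤_; _%_; s≤s; z≤n)
open import Data.Nat.Properties using (≤-trans; ≤-reflexive; n≤1+n)
open import Data.Nat.DivMod using (%-distribˡ-+)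
open import Data.Fin using (Fin)
open import Data.Product using (_×_; proj₁; proj₂; _,_)
open import Data.List using (List; []; _∷_; length; filter; map)
open import Data.List.Properties using (length-map)
open import Data.List.Relation.Binary.Permutation.Propositional using (swap; ↭-refl)
open import Data.List.Relation.Binary.Permutation.Propositional.Properties
  using (↭-length; filter-↭)
open import Data.List.Relation.Unary.All using (All; []; _∷_)
open import Data.List.Relation.Unary.AllPairs using ([]; _∷_)
open import Data.List.Relation.Unary.Unique.Propositional using (Unique)
open import Level using (0ℓ)
open import Relation.Binary.Definitions using (DecidableEquality)
open import Relation.Binary.PropositionalEquality
  using (_≡_; _≢_; refl; sym; trans; cong; module ≡-Reasoning)
open import Relation.Nullary using (yes; no)
open import Relation.Unary using (Pred; Decidable)

count : {A : Set} {P : Pred A 0ℓ} → Decidable P → List A → ℕ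
count P? L = length (filter P? L)

suc-cong-mod2 : {m n : ℕ} → m % 2 ≡ n % 2 → suc m % 2 ≡ suc n % 2
suc-cong-mod2 {m} {n} m≡n = begin
  (1 + m) % 2            ≡⟨ %-distribˡ-+ 1 m 2 ⟩
  (1 % 2 + m % 2) % 2    ≡⟨ cong (λ r → (1 % 2 + r) % 2) m≡n ⟩
  (1 % 2 + n % 2) % 2    ≡⟨ sym (%-distribˡ-+ 1 n 2) ⟩
  (1 + n) % 2            ∎
  where open ≡-Reasoning

module _ {A : Set} {P : Pred A 0ℓ} (P? : Decidable P) where

  count-∷-cong : (x : A) {Y Z : List A} → count P? Y % 2 ≡ count P? Z % 2 →
                 count P? (x ∷ Y) % 2 ≡ count P? (x ∷ Z) % 2
  count-∷-cong x {Y} {Z} Y≡Z with P? x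
  ... | yes _ = suc-cong-mod2 {count P? Y} {count P? Z} Y≡Z
  ... | no _  = Y≡Z

  count-swap : (x y : A) (Y : List A) → count P? (x ∷ y ∷ Y) ≡ count P? (y ∷ x ∷ Y)
  count-swap x y Y = ↭-length (filter-↭ P? (swap x y ↭-refl))

  count-∷∷ : (x : A) (Y : List A) → count P? (x ∷ x ∷ Y) % 2 ≡ count P? Y % 2
  count-∷∷ x Y with P? x in Px
  ... | yes _ rewrite Px = refl
  ... | no _  rewrite Px = refl

  count-map : {U : Set} (h : U → A) (X : List U) →
              count P? (map h X) ≡ count (λ x → P? (h x)) X
  count-map h [] = refl
  count-map h (x ∷ X) with P? (h x)
  ... | yes _ = cong suc (count-map h X)
  ... | no _  = count-map h X

  odd-count⇒nonempty : {Y : List A} → count P? Y % 2 ≡ 1 → Y ≢ []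
  odd-count⇒nonempty () refl

module Reduction {A : Set} (_≟_ : DecidableEquality A) where

  -- toggle a Y is the symmetric difference of the set Y with {a}.
  toggle : A → List A → List A
  toggle a [] = a ∷ []
  toggle a (y ∷ Y) with a ≟ y
  ... | yes _ = Y
  ... | no _  = y ∷ toggle a Y

  -- The reduction of a multiset modulo 2: the set of elements occurring
  -- an odd number of times.
  oddPart : List A → List A
  oddPart []      = []
  oddPart (x ∷ L) = toggle x (oddPart L)

  toggle-count : {P : Pred A 0ℓ} (P? : Decidable P) (a : A) (Y : List A) →
                 count P? (toggle a Y) % 2 ≡ count P? (a ∷ Y) % 2
  toggle-count P? a [] = refl
  toggle-count P? a (y ∷ Y) with a ≟ y
  ... | yes refl = sym (count-∷∷ P? a Y)
  toggle-count P? a (y ∷ Y) | no _ =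
    trans (count-∷-cong P? y (toggle-count P? a Y)) (cong (_% 2) (count-swap P? y a Y))

  oddPart-count : {P : Pred A 0ℓ} (P? : Decidable P) (L : List A) →
                  count P? (oddPart L) % 2 ≡ count P? L % 2
  oddPart-count P? []      = refl
  oddPart-count P? (x ∷ L) =
    trans (toggle-count P? x (oddPart L)) (count-∷-cong P? x (oddPart-count P? L))

  toggle-length : (a : A) (Y : List A) → length (toggle a Y) ≤ suc (length Y)
  toggle-length a [] = s≤s z≤n
  toggle-length a (y ∷ Y) with a ≟ y
  ... | yes _ = ≤-trans (n≤1+n _) (n≤1+n _)
  ... | no _  = s≤s (toggle-length a Y)

  oddPart-length : (L : List A) → length (oddPart L) ≤ length L
  oddPart-length []      = z≤n
  oddPart-length (x ∷ L) = ≤-trans (toggle-length x (oddPart L)) (s≤s (oddPart-length L))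

  toggle-all : {P : Pred A 0ℓ} (a : A) (Y : List A) → All P Y → P a → All P (toggle a Y)
  toggle-all a [] [] Pa = Pa ∷ []
  toggle-all a (y ∷ Y) (Py ∷ PY) Pa with a ≟ y
  ... | yes _ = PY
  ... | no _  = Py ∷ toggle-all a Y PY Pa

  -- Toggling keeps a list duplicate-free: a is added only when it is absent.
  toggle-unique : (a : A) (Y : List A) → Unique Y → Unique (toggle a Y)
  toggle-unique a [] _ = [] ∷ []
  toggle-unique a (y ∷ Y) (y∉Y ∷ Y-unique) with a ≟ y
  ... | yes _  = Y-unique
  ... | no a≢y = toggle-all a Y y∉Y (λ y≡a → a≢y (sym y≡a)) ∷ toggle-unique a Y Y-unique

  oddPart-unique : (L : List A) → Unique (oddPart L)
  oddPart-unique []      = []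
  oddPart-unique (x ∷ L) = toggle-unique x (oddPart L) (oddPart-unique L)

  oddPart-map-count : {U : Set} {P : Pred A 0ℓ} (P? : Decidable P) (h : U → A) (X : List U) →
                      count P? (oddPart (map h X)) % 2 ≡ count (λ x → P? (h x)) X % 2
  oddPart-map-count P? h X =
    trans (oddPart-count P? (map h X)) (cong (_% 2) (count-map P? h X))

  oddPart-map-length : {U : Set} (h : U → A) (X : List U) →
                       length (oddPart (map h X)) ≤ length X
  oddPart-map-length h X = ≤-trans (oddPart-length (map h X)) (≤-reflexive (length-map h X))

open Reduction

lemma9 : {U Φ Ψ : Set} (_≟Φ_ : DecidableEquality Φ) (_≟Ψ_ : DecidableEquality Ψ)
         (k c d : ℕ) → 1 ≤ k →
         (f : U → Fin c → Φ) → (g : Fin c → Φ → Fin d → Ψ) →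
         KOdd _≟Φ_ k f → ((i : Fin c) → KOdd _≟Ψ_ k (g i)) →
         KOdd _≟Ψ_ k (λ x (ij : Fin c × Fin d) → g (proj₁ ij) (f x (proj₁ ij)) (proj₂ ij))
lemma9 _≟Φ_ _≟Ψ_ k c d _ f g f-odd g-odd X X-unique X≢[] |X|≤k
  with f-odd X X-unique X≢[] |X|≤k
... | i , a , a-odd
  with g-odd i (oddPart _≟Φ_ (map (λ x → f x i) X))
         (oddPart-unique _≟Φ_ (map (λ x → f x i) X))
         (odd-count⇒nonempty (_≟Φ a)
           (trans (oddPart-map-count _≟Φ_ (_≟Φ a) (λ x → f x i) X) a-odd))
         (≤-trans (oddPart-map-length _≟Φ_ (λ x → f x i) X) |X|≤k)
... | j , b , b-odd =
  (i , j) , b , trans (sym (oddPart-map-count _≟Φ_ (λ φ → g i φ j ≟Ψ b) (λ x → f x i) X)) b-odd
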